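{- Let $b\ge 3$ be an integer and let $d_1,d_2$ be integers with $0\le d_1<d_2\le b-1$; set $u=d_2-d_1$ and write $u=u_1u_2$ with $u_1,u_2$ positive integers such that every prime factor of $u_1$ divides $b$ and no prime factor of $u_2$ divides $b$. Let $N=\varphi(u_2^2(b-1)^2)$, where $\varphi$ is Euler's totient function, and let $m_1=N-1$. Then $u_1$ divides $b^{m_1}$, and the reduced fraction $p_1/q_1=(0.\,d_1^{m_1}\,\overline{d_2d_1^{m_1}})_b$ satisfies $u_2q_1=b^N-1$.
   Context: For a digit $d$ and $m\ge 0$, $d^{m}$ denotes the word consisting of $m$ copies of $d$. The notation $(0.v\,\overline{w})_b$ denotes the real number whose base $b$ expansion is $0.$ followed by the digits of the word $v$ and then the digits of the word $w$ repeated periodically forever. -}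

module Defs where

open import Data.Nat using (ℕ; zero; suc; _+_; _*_; _∸_; _^_)
open import Data.Nat.GCD using (gcd)
open import Data.Nat.Properties using (_≟_)
open import Data.List using (List; []; _∷_; foldl; length; filter; map; upTo)
open import Data.Integer using (+_)
open import Data.Rational using (ℚ; fromℚᵘ)
open import Data.Rational.Unnormalised using (mkℚᵘ)

φ : ℕ → ℕ
φ n = length (filter (λ k → gcd k n ≟ 1) (map suc (upTo n)))

wordVal : ℕ → List ℕ → ℕ
wordVal b ds = foldl (λ acc d → acc * b + d) 0 ds

-- (0.v w̄)_b as a rational number (normalised, i.e. in lowest terms):
--   (0.v w̄)_b = Σ_{i≥1} digit_i b^{-i}
--             = ( [v]_b (b^{|w|} - 1) + [w]_b ) / ( b^{|v|} (b^{|w|} - 1) ).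
-- The denominator D is encoded as mkℚᵘ num (D ∸ 1); this is exact whenever
-- D ≥ 1, i.e. b ≥ 2 and w nonempty (which holds in every use below).
expansion : ℕ → List ℕ → List ℕ → ℚ
expansion b v w =
  fromℚᵘ (mkℚᵘ (+ (wordVal b v * (b ^ length w ∸ 1) + wordVal b w))
               (b ^ length v * (b ^ length w ∸ 1) ∸ 1))

module Submission where

-- Plan.
-- * Euler's theorem n ∣ b^φ(n) − 1 for b coprime to n ≥ 2, via the classical argument that
--   k ↦ bk mod n permutes the reduced residues. The list bookkeeping is a pigeonhole lemma:
--   a duplicate-free list whose members all occur in a list no longer than itself is a
--   permutation of that list.
-- * φ(c²) ≥ c (the numbers 1 + tc, t < c, are units mod c²); hence N ≥ u₂B ≥ B ≥ u₁.
-- * If all prime factors of u divide b and u ≤ m + 1, then u ∣ bᵐ, since u has fewer than u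
--   prime factors (counted with multiplicity); this gives the first claim.
-- * With P = bᵐ and M = bᵐ⁺¹ − 1, the expansion equals (RM + d₂P + R)/(PM) where
--   R = [d₁ᵐ]_b, and B·(RM + d₂P + R) = P(d₁M + Bu₁u₂). If u₂B² ∣ M (true by Euler, since
--   M = bᴺ − 1) write M = u₂BA; numerator and denominator are Pu₂(d₁A + u₁) and Pu₂(BA),
--   and d₁A + u₁ is coprime to BA because u₁ ∣ M + 1. So the reduced denominator is BA = M/u₂.

open import Defs
open import Data.Nat using (ℕ; zero; suc; _+_; _*_; _∸_; _^_; _≤_; _<_; z≤n; s≤s; NonZero; ≢-nonZero; >-nonZero; >-nonZero⁻¹; nonTrivial⇒n>1; _%_)
open import Data.Nat.Properties
open import Data.Nat.DivMod using (m≡m%n+[m/n]*n; m%n<n; m%n%n≡m%n; %-distribˡ-*; _/_)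
open import Data.Nat.Divisibility
open import Data.Nat.Coprimality using (Coprime; coprime-divisor; coprime⇒gcd≡1; gcd≡1⇒coprime) renaming (sym to coprime-sym)
open import Data.Nat.GCD using (gcd; c*gcd[m,n]≡gcd[cm,cn])
open import Data.Nat.Primality using (Prime; prime⇒nonTrivial)
open import Data.Nat.Primality.Factorisation using (factorise)
open import Data.Nat.ListAction using (product)
open import Data.Nat.ListAction.Properties using (product-↭; ∈⇒∣product)
open import Data.Nat.Tactic.RingSolver using (solve-∀)
open import Data.List using (List; []; _∷_; _++_; length; map; filter; upTo; foldl; replicate)
open import Data.List.Properties using (length-map; length-upTo; length-replicate)
open import Data.List.Membership.Propositional using (_∈_)
open import Data.List.Membership.Propositional.Properties
  using (∈-∃++; ∈-++⁻; ∈-++⁺ˡ; ∈-++⁺ʳ; ∈-map⁺; ∈-map⁻; ∈-filter⁺; ∈-filter⁻; ∈-upTo⁺; ∈-upTo⁻)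
open import Data.List.Relation.Binary.Subset.Propositional using (_⊆_)
open import Data.List.Relation.Binary.Permutation.Propositional using (_↭_; prep; ↭-refl; ↭-sym; ↭-trans)
open import Data.List.Relation.Binary.Permutation.Propositional.Properties using (↭-length; shift)
open import Data.List.Relation.Unary.All using (All; []; _∷_; lookup; tabulate)
import Data.List.Relation.Unary.All.Properties as All
open import Data.List.Relation.Unary.AllPairs using ([]; _∷_)
open import Data.List.Relation.Unary.Any using (here; there)
open import Data.List.Relation.Unary.Unique.Propositional using (Unique)
import Data.List.Relation.Unary.Unique.Propositional.Properties as Unique
import Data.Integer as ℤ using (+_)
import Data.Integer.Properties as ℤ
open import Data.Rational using (↧ₙ_; normalize; fromℚᵘ)
open import Data.Rational.Properties using (↧-normalize)
open import Data.Rational.Unnormalised using (mkℚᵘ)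
open import Data.Product using (_×_; _,_; ∃-syntax)
open import Data.Sum using (inj₁; inj₂)
open import Data.Empty using (⊥-elim)
open import Function using (_∘_)
open import Relation.Nullary using (¬_)
open import Relation.Binary.PropositionalEquality

⊆-delete : ∀ {x : ℕ} {xs} as bs → All (x ≢_) xs → xs ⊆ as ++ x ∷ bs → xs ⊆ as ++ bs
⊆-delete as bs x∉xs xs⊆ y∈xs with ∈-++⁻ as (xs⊆ y∈xs)
... | inj₁ y∈as = ∈-++⁺ˡ y∈as
... | inj₂ (here refl) = ⊥-elim (lookup x∉xs y∈xs refl)
... | inj₂ (there y∈bs) = ∈-++⁺ʳ as y∈bs

length-delete : ∀ (x : ℕ) as bs → length (as ++ x ∷ bs) ≡ suc (length (as ++ bs))
length-delete x as bs = ↭-length (shift x as bs)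

unique-⊆⇒length≤ : ∀ {xs ys : List ℕ} → Unique xs → xs ⊆ ys → length xs ≤ length ys
unique-⊆⇒length≤ {[]} _ _ = z≤n
unique-⊆⇒length≤ {x ∷ xs} (x∉xs ∷ xs!) xs⊆ with as , bs , refl ← ∈-∃++ (xs⊆ (here refl)) =
  ≤-trans (s≤s (unique-⊆⇒length≤ xs! (⊆-delete as bs x∉xs (xs⊆ ∘ there))))
          (≤-reflexive (sym (length-delete x as bs)))

unique-⊆⇒↭ : ∀ {xs ys : List ℕ} → Unique xs → xs ⊆ ys → length ys ≤ length xs → xs ↭ ys
unique-⊆⇒↭ {[]} {[]} _ _ _ = ↭-refl
unique-⊆⇒↭ {[]} {y ∷ ys} _ _ ()
unique-⊆⇒↭ {x ∷ xs} (x∉xs ∷ xs!) xs⊆ len with as , bs , refl ← ∈-∃++ (xs⊆ (here refl)) =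
  ↭-trans (prep x (unique-⊆⇒↭ xs! (⊆-delete as bs x∉xs (xs⊆ ∘ there)) len′)) (↭-sym (shift x as bs))
  where
  len′ : length (as ++ bs) ≤ length xs
  len′ = ≤-pred (≤-trans (≤-reflexive (sym (length-delete x as bs))) len)

unique-map : ∀ (f : ℕ → ℕ) {xs} → (∀ {x y} → x ∈ xs → y ∈ xs → f x ≡ f y → x ≡ y) →
  Unique xs → Unique (map f xs)
unique-map f {[]} _ [] = []
unique-map f {x ∷ xs} inj (x∉xs ∷ xs!) =
  All.map⁺ (tabulate λ y∈xs fx≡fy → lookup x∉xs y∈xs (inj (here refl) (there y∈xs) fx≡fy))
  ∷ unique-map f (λ p q → inj (there p) (there q)) xs!

coprime-* : ∀ {m n o} → Coprime m n → Coprime m o → Coprime m (n * o)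
coprime-* {m} {n} m⊥n m⊥o {d} (d∣m , d∣no) = m⊥o (d∣m , coprime-divisor d⊥n d∣no)
  where
  d⊥n : Coprime d n
  d⊥n (e∣d , e∣n) = m⊥n (∣-trans e∣d d∣m , e∣n)

coprime-product : ∀ {m} xs → All (Coprime m) xs → Coprime m (product xs)
coprime-product [] [] (_ , d∣1) = ∣1⇒≡1 d∣1
coprime-product (x ∷ xs) (m⊥x ∷ m⊥xs) = coprime-* m⊥x (coprime-product xs m⊥xs)

coprime-∣ : ∀ {m n o} → Coprime m n → o ∣ n → Coprime m o
coprime-∣ m⊥n o∣n (d∣m , d∣o) = m⊥n (d∣m , ∣-trans d∣o o∣n)

coprime-suc : ∀ {u M A} → u ∣ suc M → A ∣ M → Coprime u A
coprime-suc {M = M} u∣1+M A∣M {d} (d∣u , d∣A) =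
  ∣1⇒≡1 (∣m+n∣m⇒∣n (subst (d ∣_) (+-comm 1 M) (∣-trans d∣u u∣1+M)) (∣-trans d∣A A∣M))

coprime-+* : ∀ {u A} d → Coprime u A → Coprime (d * A + u) A
coprime-+* d u⊥A (g∣dA+u , g∣A) = u⊥A (∣m+n∣m⇒∣n g∣dA+u (∣n⇒∣m*n d g∣A) , g∣A)

coprime-consecutive : ∀ B → Coprime (suc B) B
coprime-consecutive B {d} (d∣1+B , d∣B) = ∣1⇒≡1 (∣m+n∣m⇒∣n (subst (d ∣_) (+-comm 1 B) d∣1+B) d∣B)

coprime⇒∤ : ∀ {m n} → 2 ≤ n → Coprime m n → ¬ (n ∣ m)
coprime⇒∤ 2≤n m⊥n n∣m = <⇒≢ 2≤n (sym (m⊥n (n∣m , ∣-refl)))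

prime-divisor : ∀ d → 2 ≤ d → ∃[ p ] Prime p × p ∣ d
prime-divisor d@(suc _) 2≤d with factorise d
... | record { factors = [] ; isFactorisation = d≡1 } = ⊥-elim (<⇒≢ 2≤d (sym d≡1))
... | record { factors = p ∷ ps ; isFactorisation = d≡p*ps ; factorsPrime = p-prime ∷ _ } =
  p , p-prime , ∣-trans (m∣m*n (product ps)) (∣-reflexive (sym d≡p*ps))

no-common-prime⇒coprime : ∀ b u → 1 ≤ u → (∀ p → Prime p → p ∣ u → ¬ (p ∣ b)) → Coprime b u
no-common-prime⇒coprime b u 1≤u h {zero} (_ , 0∣u) = ⊥-elim (<⇒≢ 1≤u (sym (0∣⇒≡0 0∣u)))
no-common-prime⇒coprime b u 1≤u h {suc zero} _ = refl
no-common-prime⇒coprime b u 1≤u h {d@(suc (suc _))} (d∣b , d∣u) with prime-divisor d (s≤s (s≤s z≤n))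
... | p , p-prime , p∣d = ⊥-elim (h p p-prime (∣-trans p∣d d∣u) (∣-trans p∣d d∣b))

residues : ℕ → List ℕ
residues n = filter (λ k → gcd k n ≟ 1) (map suc (upTo n))

∈-residues⁺ : ∀ {n k} → 0 < k → k ≤ n → Coprime k n → k ∈ residues n
∈-residues⁺ {n} {suc j} _ j<n k⊥n =
  ∈-filter⁺ (λ k → gcd k n ≟ 1) (∈-map⁺ suc (∈-upTo⁺ j<n)) (coprime⇒gcd≡1 k⊥n)

∈-residues⁻ : ∀ {n k} → 2 ≤ n → k ∈ residues n → 0 < k × k < n × Coprime k n
∈-residues⁻ {n} {k} 2≤n k∈ with ∈-filter⁻ (λ k → gcd k n ≟ 1) {xs = map suc (upTo n)} k∈
... | k∈1…n , gcd≡1 with ∈-map⁻ suc {xs = upTo n} k∈1…n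
... | j , j∈ , refl = s≤s z≤n , k<n , k⊥n
  where
  k⊥n : Coprime k n
  k⊥n = gcd≡1⇒coprime gcd≡1
  k<n : k < n
  k<n with m≤n⇒m<n∨m≡n (∈-upTo⁻ j∈)
  ... | inj₁ k<n = k<n
  ... | inj₂ refl = ⊥-elim (coprime⇒∤ 2≤n k⊥n ∣-refl)

unique-residues : ∀ n → Unique (residues n)
unique-residues n = Unique.filter⁺ (λ k → gcd k n ≟ 1) (Unique.map⁺ suc-injective (Unique.upTo⁺ n))

%-≡⇒∣∸ : ∀ {a c} n .{{_ : NonZero n}} → a % n ≡ c % n → a ≤ c → n ∣ c ∸ a
%-≡⇒∣∸ {a} {c} n a≡c a≤c = divides (c / n ∸ a / n) (begin
  c ∸ a                                         ≡⟨ cong₂ _∸_ (m≡m%n+[m/n]*n c n) (trans (m≡m%n+[m/n]*n a n) (cong (_+ (a / n) * n) a≡c)) ⟩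
  (c % n + (c / n) * n) ∸ (c % n + (a / n) * n) ≡⟨ [m+n]∸[m+o]≡n∸o (c % n) _ _ ⟩
  (c / n) * n ∸ (a / n) * n                     ≡⟨ sym (*-distribʳ-∸ n (c / n) (a / n)) ⟩
  (c / n ∸ a / n) * n                           ∎)
  where open ≡-Reasoning

∣∧<⇒≡0 : ∀ {n m} → n ∣ m → m < n → m ≡ 0
∣∧<⇒≡0 {m = zero} _ _ = refl
∣∧<⇒≡0 {m = suc m} n∣m m<n = ⊥-elim (>⇒∤ m<n n∣m)

module Euler {b n : ℕ} .{{_ : NonZero n}} (2≤n : 2 ≤ n) (b⊥n : Coprime b n) where

  times-b : ℕ → ℕ
  times-b k = b * k % n

  times-b-residue : ∀ {k} → k ∈ residues n → times-b k ∈ residues n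
  times-b-residue {k} k∈ with ∈-residues⁻ 2≤n k∈
  ... | _ , _ , k⊥n = ∈-residues⁺ (n≢0⇒n>0 bk%n≢0) (<⇒≤ (m%n<n (b * k) n)) bk%n⊥n
    where
    bk⊥n : Coprime (b * k) n
    bk⊥n = coprime-sym (coprime-* (coprime-sym b⊥n) (coprime-sym k⊥n))
    bk%n⊥n : Coprime (b * k % n) n
    bk%n⊥n (d∣bk%n , d∣n) = bk⊥n (∣n∣m%n⇒∣m d∣n d∣bk%n , d∣n)
    bk%n≢0 : b * k % n ≢ 0
    bk%n≢0 bk%n≡0 = coprime⇒∤ 2≤n bk⊥n (m%n≡0⇒n∣m (b * k) n bk%n≡0)

  -- b is invertible mod n, so bk ≡ bk′ forces n ∣ k′ − k < n.
  times-b-injective≤ : ∀ {k k′} → k′ ∈ residues n → k ≤ k′ → times-b k ≡ times-b k′ → k ≡ k′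
  times-b-injective≤ {k} {k′} k′∈ k≤k′ eq = ≤-antisym k≤k′ (m∸n≡0⇒m≤n (∣∧<⇒≡0 n∣k′-k k′-k<n))
    where
    n∣k′-k : n ∣ k′ ∸ k
    n∣k′-k = coprime-divisor (coprime-sym b⊥n)
      (subst (n ∣_) (sym (*-distribˡ-∸ b k′ k)) (%-≡⇒∣∸ n eq (*-monoʳ-≤ b k≤k′)))
    k′-k<n : k′ ∸ k < n
    k′-k<n with ∈-residues⁻ 2≤n k′∈
    ... | _ , k′<n , _ = ≤-<-trans (m∸n≤m k′ k) k′<n

  times-b-injective : ∀ {k k′} → k ∈ residues n → k′ ∈ residues n → times-b k ≡ times-b k′ → k ≡ k′
  times-b-injective {k} {k′} k∈ k′∈ eq with ≤-total k k′
  ... | inj₁ k≤k′ = times-b-injective≤ k′∈ k≤k′ eq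
  ... | inj₂ k′≤k = sym (times-b-injective≤ k∈ k′≤k (sym eq))

  -- By the pigeonhole lemma, an injective self-map of the residues permutes them.
  times-b-permutes : map times-b (residues n) ↭ residues n
  times-b-permutes = unique-⊆⇒↭
    (unique-map times-b times-b-injective (unique-residues n))
    image⊆
    (≤-reflexive (sym (length-map times-b (residues n))))
    where
    image⊆ : map times-b (residues n) ⊆ residues n
    image⊆ y∈ with ∈-map⁻ times-b y∈
    ... | k , k∈ , refl = times-b-residue k∈

  product-times-b : ∀ xs → product (map times-b xs) % n ≡ b ^ length xs * product xs % n
  product-times-b [] = refl
  product-times-b (x ∷ xs) = begin
    (times-b x * product (map times-b xs)) % n          ≡⟨ %-distribˡ-* (times-b x) _ n ⟩
    (times-b x % n * (product (map times-b xs) % n)) % n ≡⟨ cong₂ (λ u v → (u * v) % n) (m%n%n≡m%n (b * x) n) (product-times-b xs) ⟩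
    (times-b x * (b ^ length xs * product xs % n)) % n  ≡⟨ sym (%-distribˡ-* (b * x) _ n) ⟩
    (b * x * (b ^ length xs * product xs)) % n          ≡⟨ cong (_% n) (regroup b x (b ^ length xs) (product xs)) ⟩
    (b * b ^ length xs * (x * product xs)) % n          ∎
    where
    open ≡-Reasoning
    regroup : ∀ b x B P → b * x * (B * P) ≡ b * B * (x * P)
    regroup = solve-∀

  -- Comparing products: P ≡ b^φ(n)·P (mod n) with P a unit, so n ∣ b^φ(n) − 1.
  theorem : n ∣ b ^ φ n ∸ 1
  theorem = coprime-divisor (coprime-sym P⊥n) n∣P*[b^φ-1]
    where
    P = product (residues n)
    P⊥n : Coprime P n
    P⊥n = coprime-sym (coprime-product (residues n)
      (tabulate λ k∈ → let (_ , _ , k⊥n) = ∈-residues⁻ 2≤n k∈ in coprime-sym k⊥n))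
    P≡b^φP : P % n ≡ b ^ φ n * P % n
    P≡b^φP = trans (cong (_% n) (sym (product-↭ times-b-permutes))) (product-times-b (residues n))
    b≢0 : NonZero b
    b≢0 = ≢-nonZero λ b≡0 → coprime⇒∤ 2≤n b⊥n (subst (n ∣_) (sym b≡0) (n ∣0))
    n∣P*[b^φ-1] : n ∣ P * (b ^ φ n ∸ 1)
    n∣P*[b^φ-1] = subst (n ∣_) (begin
      b ^ φ n * P ∸ P     ≡⟨ cong (b ^ φ n * P ∸_) (sym (*-identityˡ P)) ⟩
      b ^ φ n * P ∸ 1 * P ≡⟨ sym (*-distribʳ-∸ P (b ^ φ n) 1) ⟩
      (b ^ φ n ∸ 1) * P   ≡⟨ *-comm _ P ⟩
      P * (b ^ φ n ∸ 1)   ∎)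
      (%-≡⇒∣∸ n P≡b^φP (m≤n*m P (b ^ φ n) {{m^n≢0 b (φ n) {{b≢0}}}}))
      where open ≡-Reasoning

euler : ∀ b n → 2 ≤ n → Coprime b n → n ∣ b ^ φ n ∸ 1
euler b n 2≤n b⊥n = Euler.theorem {{>-nonZero (≤-trans (s≤s z≤n) 2≤n)}} 2≤n b⊥n

-- The c numbers 1 + t·c (t < c) are distinct units modulo c², hence φ(c²) ≥ c.
φ-square≥ : ∀ c .{{_ : NonZero c}} → c ≤ φ (c * c)
φ-square≥ c = subst (_≤ φ (c * c)) length-units (unique-⊆⇒length≤ unique-units units⊆residues)
  where
  unit : ℕ → ℕ
  unit t = suc (t * c)
  units = map unit (upTo c)
  length-units : length units ≡ c
  length-units = trans (length-map unit (upTo c)) (length-upTo c)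
  unique-units : Unique units
  unique-units = Unique.map⁺ (λ eq → *-cancelʳ-≡ _ _ c (suc-injective eq)) (Unique.upTo⁺ c)
  unit⊥c : ∀ t → Coprime (unit t) c
  unit⊥c t {d} (d∣1+tc , d∣c) =
    ∣1⇒≡1 (∣m+n∣m⇒∣n (subst (d ∣_) (+-comm 1 (t * c)) d∣1+tc) (∣n⇒∣m*n t d∣c))
  units⊆residues : units ⊆ residues (c * c)
  units⊆residues u∈ with ∈-map⁻ unit u∈
  ... | t , t∈ , refl = ∈-residues⁺ (s≤s z≤n) (*-monoˡ-< c (∈-upTo⁻ t∈))
    (coprime-* (unit⊥c t) (unit⊥c t))

length<product : ∀ ps → All Prime ps → length ps < product ps
length<product [] [] = s≤s z≤n
length<product (p ∷ ps) (p-prime ∷ ps-prime) = begin-strict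
  suc L    <⟨ s≤s L<P ⟩
  suc P    ≤⟨ +-monoˡ-≤ P (≤-trans (s≤s z≤n) L<P) ⟩
  P + P    ≡⟨ cong (P +_) (sym (+-identityʳ P)) ⟩
  2 * P    ≤⟨ *-monoˡ-≤ P (nonTrivial⇒n>1 p {{prime⇒nonTrivial p-prime}}) ⟩
  p * P    ∎
  where
  open ≤-Reasoning
  L = length ps
  P = product ps
  L<P = length<product ps ps-prime

product∣power : ∀ {b} ps → All (_∣ b) ps → product ps ∣ b ^ length ps
product∣power [] [] = ∣-refl
product∣power (p ∷ ps) (p∣b ∷ ps∣b) = *-pres-∣ p∣b (product∣power ps ps∣b)

^-monoʳ-∣ : ∀ b {L m} → L ≤ m → b ^ L ∣ b ^ m
^-monoʳ-∣ b {L} {m} L≤m = divides (b ^ (m ∸ L)) (begin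
  b ^ m                ≡⟨ cong (b ^_) (sym (m+[n∸m]≡n L≤m)) ⟩
  b ^ (L + (m ∸ L))    ≡⟨ ^-distribˡ-+-* b L (m ∸ L) ⟩
  b ^ L * b ^ (m ∸ L)  ≡⟨ *-comm (b ^ L) _ ⟩
  b ^ (m ∸ L) * b ^ L  ∎)
  where open ≡-Reasoning

radical∣b⇒∣power : ∀ u b m → 1 ≤ u → (∀ p → Prime p → p ∣ u → p ∣ b) → u ≤ suc m → u ∣ b ^ m
radical∣b⇒∣power u@(suc _) b m _ primes∣b u≤1+m with factorise u
... | record { factors = ps ; isFactorisation = u≡∏ps ; factorsPrime = ps-prime } =
  ∣-trans (∣-reflexive u≡∏ps) (∣-trans (product∣power ps ps∣b) (^-monoʳ-∣ b L≤m))
  where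
  ps∣b : All (_∣ b) ps
  ps∣b = tabulate λ {p} p∈ → primes∣b p (lookup ps-prime p∈)
    (∣-trans (∈⇒∣product p∈) (∣-reflexive (sym u≡∏ps)))
  L≤m : length ps ≤ m
  L≤m = ≤-pred (≤-trans (length<product ps ps-prime) (≤-trans (≤-reflexive (sym u≡∏ps)) u≤1+m))

foldl-digits : ∀ b a ds → foldl (λ acc d → acc * b + d) a ds ≡ a * b ^ length ds + wordVal b ds
foldl-digits b a [] = sym (trans (+-identityʳ _) (*-identityʳ a))
foldl-digits b a (d ∷ ds) = begin
  foldl (λ acc d → acc * b + d) (a * b + d) ds ≡⟨ foldl-digits b (a * b + d) ds ⟩
  (a * b + d) * b ^ L + W                      ≡⟨ regroup a b d (b ^ L) W ⟩
  a * (b * b ^ L) + (d * b ^ L + W)            ≡⟨ cong (a * (b * b ^ L) +_) (sym (foldl-digits b d ds)) ⟩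
  a * (b * b ^ L) + wordVal b (d ∷ ds)         ∎
  where
  open ≡-Reasoning
  L = length ds
  W = wordVal b ds
  regroup : ∀ a b d Q W → (a * b + d) * Q + W ≡ a * (b * Q) + (d * Q + W)
  regroup = solve-∀

-- Repdigits: (b − 1)·[dᵐ]_b + d = d·bᵐ, in the accumulator form needed for induction.
repdigit-acc : ∀ B d m a →
  B * foldl (λ acc d → acc * suc B + d) a (replicate m d) + d ≡ (B * a + d) * suc B ^ m
repdigit-acc B d zero a = sym (*-identityʳ _)
repdigit-acc B d (suc m) a = begin
  B * foldl (λ acc d → acc * suc B + d) (a * suc B + d) (replicate m d) + d
      ≡⟨ repdigit-acc B d m (a * suc B + d) ⟩
  (B * (a * suc B + d) + d) * suc B ^ m ≡⟨ regroup B a d (suc B ^ m) ⟩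
  (B * a + d) * (suc B * suc B ^ m)     ∎
  where
  open ≡-Reasoning
  regroup : ∀ B a d Q → (B * (a * suc B + d) + d) * Q ≡ (B * a + d) * (suc B * Q)
  regroup = solve-∀

repdigit : ∀ B d m → B * wordVal (suc B) (replicate m d) + d ≡ d * suc B ^ m
repdigit B d m = trans (repdigit-acc B d m 0) (cong (λ z → (z + d) * suc B ^ m) (*-zeroʳ B))

denominator*gcd : ∀ i D′ → ↧ₙ (fromℚᵘ (mkℚᵘ (ℤ.+ i) D′)) * gcd i (suc D′) ≡ suc D′
denominator*gcd i D′ =
  ℤ.+-injective (trans (ℤ.pos-* (↧ₙ (normalize i (suc D′))) (gcd i (suc D′))) (↧-normalize i (suc D′)))

reduced-denominator : ∀ {i D} c x y .{{_ : NonZero (c * y)}} → i ≡ c * x → D ≡ c * y → Coprime x y →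
  ↧ₙ (fromℚᵘ (mkℚᵘ (ℤ.+ i) (D ∸ 1))) ≡ y
reduced-denominator c x y refl refl x⊥y = *-cancelʳ-≡ q y c {{m*n≢0⇒m≢0 c}} (begin
  q * c                                ≡⟨ cong (q *_) (sym gcd≡c) ⟩
  q * gcd (c * x) (suc (c * y ∸ 1))    ≡⟨ denominator*gcd (c * x) (c * y ∸ 1) ⟩
  suc (c * y ∸ 1)                      ≡⟨ suc-pred (c * y) ⟩
  c * y                                ≡⟨ *-comm c y ⟩
  y * c                                ∎)
  where
  open ≡-Reasoning
  q = ↧ₙ (fromℚᵘ (mkℚᵘ (ℤ.+ (c * x)) (c * y ∸ 1)))
  gcd≡c : gcd (c * x) (suc (c * y ∸ 1)) ≡ c
  gcd≡c = begin
    gcd (c * x) (suc (c * y ∸ 1)) ≡⟨ cong (gcd (c * x)) (suc-pred (c * y)) ⟩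
    gcd (c * x) (c * y)           ≡⟨ sym (c*gcd[m,n]≡gcd[cm,cn] c x y) ⟩
    c * gcd x y                   ≡⟨ cong (c *_) (coprime⇒gcd≡1 x⊥y) ⟩
    c * 1                         ≡⟨ *-identityʳ c ⟩
    c                             ∎

module PeriodicExpansion (B m d₁ d₂ : ℕ) where
  b = suc B
  P = b ^ m
  M = b ^ suc m ∸ 1
  R = wordVal b (replicate m d₁)

  suc-M : suc M ≡ b * P
  suc-M = suc-pred (b * P) {{m^n≢0 b (suc m)}}

  raw-numerator raw-denominator : ℕ
  raw-numerator = wordVal b (replicate m d₁) * (b ^ length (d₂ ∷ replicate m d₁) ∸ 1)
                    + wordVal b (d₂ ∷ replicate m d₁)
  raw-denominator = b ^ length (replicate m d₁) * (b ^ length (d₂ ∷ replicate m d₁) ∸ 1)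

  numerator-≡ : raw-numerator ≡ R * M + (d₂ * P + R)
  numerator-≡ = cong₂ (λ L W → R * (b ^ suc L ∸ 1) + W) (length-replicate m) period-value
    where
    period-value : wordVal b (d₂ ∷ replicate m d₁) ≡ d₂ * P + R
    period-value = trans (foldl-digits b d₂ (replicate m d₁))
                         (cong (λ L → d₂ * b ^ L + R) (length-replicate m))

  denominator-≡ : raw-denominator ≡ P * M
  denominator-≡ = cong (λ L → b ^ L * (b ^ suc L ∸ 1)) (length-replicate m)

  -- Summing the geometric series: B times the numerator is P·(d₁M + B(d₂ − d₁)).
  numerator-identity : ∀ u → d₂ ≡ d₁ + u → B * (R * M + (d₂ * P + R)) ≡ P * (d₁ * M + B * u)
  numerator-identity u refl = +-cancelʳ-≡ (d₁ * suc M) _ _ (begin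
    B * (R * M + ((d₁ + u) * P + R)) + d₁ * suc M
        ≡⟨ regroup₁ B R M d₁ u P ⟩
    (B * R + d₁) * suc M + B * (d₁ + u) * P
        ≡⟨ cong (λ z → z * suc M + B * (d₁ + u) * P) (repdigit B d₁ m) ⟩
    d₁ * P * suc M + B * (d₁ + u) * P
        ≡⟨ regroup₂ B M d₁ u P ⟩
    P * (d₁ * M + B * u) + d₁ * (P + B * P)
        ≡⟨ cong (λ z → P * (d₁ * M + B * u) + d₁ * z) (sym suc-M) ⟩
    P * (d₁ * M + B * u) + d₁ * suc M ∎)
    where
    open ≡-Reasoning
    regroup₁ : ∀ B R M d u P → B * (R * M + ((d + u) * P + R)) + d * suc M
                              ≡ (B * R + d) * suc M + B * (d + u) * P
    regroup₁ = solve-∀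
    regroup₂ : ∀ B M d u P → d * P * suc M + B * (d + u) * P ≡ P * (d * M + B * u) + d * (P + B * P)
    regroup₂ = solve-∀

-- If u₁ ∣ bᵐ and u₂B² ∣ M, the periodic expansion with d₂ − d₁ = u₁u₂ has reduced
-- denominator M/u₂: writing M = u₂BA, the fraction is Pu₂(d₁A + u₁) / Pu₂(BA).
periodic-denominator : ∀ B m d₁ d₂ u₁ u₂ .{{_ : NonZero B}} → d₂ ≡ d₁ + u₁ * u₂ →
  u₁ ∣ suc B ^ m → u₂ * B * B ∣ suc B ^ suc m ∸ 1 →
  u₂ * ↧ₙ (expansion (suc B) (replicate m d₁) (d₂ ∷ replicate m d₁)) ≡ suc B ^ suc m ∸ 1
periodic-denominator B m d₁ d₂ u₁ u₂ d₂≡ u₁∣P (divides K M≡) = begin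
  u₂ * ↧ₙ (expansion b (replicate m d₁) (d₂ ∷ replicate m d₁))
      ≡⟨ cong (u₂ *_) (reduced-denominator (P * u₂) X Y {{PM≢0}} numerator denominator X⊥Y) ⟩
  u₂ * (B * A) ≡⟨ sym M≡u₂BA ⟩
  M            ∎
  where
  open ≡-Reasoning
  open PeriodicExpansion B m d₁ d₂
  A = B * K
  X = d₁ * A + u₁
  Y = B * A
  M≡u₂BA : M ≡ u₂ * (B * A)
  M≡u₂BA = trans M≡ (regroup K u₂ B)
    where
    regroup : ∀ K u B → K * (u * B * B) ≡ u * (B * (B * K))
    regroup = solve-∀
  numerator : raw-numerator ≡ (P * u₂) * X
  numerator = trans numerator-≡ (*-cancelˡ-≡ _ _ B (begin
    B * (R * M + (d₂ * P + R))        ≡⟨ numerator-identity (u₁ * u₂) d₂≡ ⟩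
    P * (d₁ * M + B * (u₁ * u₂))      ≡⟨ cong (λ z → P * (d₁ * z + B * (u₁ * u₂))) M≡u₂BA ⟩
    P * (d₁ * (u₂ * (B * A)) + B * (u₁ * u₂)) ≡⟨ regroup P d₁ u₂ B A u₁ ⟩
    B * ((P * u₂) * (d₁ * A + u₁))    ∎))
    where
    regroup : ∀ P d u B A v → P * (d * (u * (B * A)) + B * (v * u)) ≡ B * ((P * u) * (d * A + v))
    regroup = solve-∀
  denominator : raw-denominator ≡ (P * u₂) * Y
  denominator = trans denominator-≡ (trans (cong (P *_) M≡u₂BA) (sym (*-assoc P u₂ Y)))
  PM≢0 : NonZero ((P * u₂) * Y)
  PM≢0 = subst NonZero (trans (sym denominator-≡) denominator) (m*n≢0 P M {{m^n≢0 b m}} {{M≢0}})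
    where
    M≢0 : NonZero M
    M≢0 = >-nonZero (≤-trans (>-nonZero⁻¹ B) (∸-monoˡ-≤ 1 (m≤m*n b P {{m^n≢0 b m}})))
  X⊥Y : Coprime X Y
  X⊥Y = coprime-* (coprime-∣ X⊥A (divides K (*-comm B K))) X⊥A
    where
    X⊥A : Coprime X A
    X⊥A = coprime-+* d₁ (coprime-suc (subst (u₁ ∣_) (sym suc-M) (∣n⇒∣m*n b u₁∣P))
                                     (divides (u₂ * B) (trans M≡u₂BA (regroup u₂ B A))))
      where
      regroup : ∀ u B A → u * (B * A) ≡ u * B * A
      regroup = solve-∀

square-product : ∀ u B → u * B * (u * B) ≡ u ^ 2 * B ^ 2
square-product u B = regroup u B
  where
  regroup : ∀ u B → u * B * (u * B) ≡ (u * (u * 1)) * (B * (B * 1))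
  regroup = solve-∀

φ-bound : ∀ u₂ B .{{_ : NonZero u₂}} .{{_ : NonZero B}} → B ≤ φ (u₂ ^ 2 * B ^ 2)
φ-bound u₂ B = ≤-trans (m≤n*m B u₂)
  (subst (λ n → u₂ * B ≤ φ n) (square-product u₂ B) (φ-square≥ (u₂ * B) {{m*n≢0 u₂ B}}))

u₂B²∣bᴺ-1 : ∀ u₂ B → 2 ≤ B → 1 ≤ u₂ → Coprime (suc B) u₂ →
  u₂ * B * B ∣ suc B ^ φ (u₂ ^ 2 * B ^ 2) ∸ 1
u₂B²∣bᴺ-1 u₂ B 2≤B 1≤u₂ b⊥u₂ = ∣-trans (divides u₂ (regroup u₂ B)) (euler (suc B) n 2≤n b⊥n)
  where
  instance
    u₂≢0 : NonZero u₂
    u₂≢0 = >-nonZero 1≤u₂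
    B≢0 : NonZero B
    B≢0 = >-nonZero (≤-trans (s≤s z≤n) 2≤B)
  n = u₂ ^ 2 * B ^ 2
  c = u₂ * B
  2≤n : 2 ≤ n
  2≤n = subst (2 ≤_) (square-product u₂ B)
    (≤-trans 2≤B (≤-trans (m≤n*m B u₂) (m≤m*n c c {{m*n≢0 u₂ B}})))
  b⊥n : Coprime (suc B) n
  b⊥n = subst (Coprime (suc B)) (square-product u₂ B) (coprime-* b⊥c b⊥c)
    where
    b⊥c : Coprime (suc B) c
    b⊥c = coprime-* b⊥u₂ (coprime-consecutive B)
  regroup : ∀ u B → (u * (u * 1)) * (B * (B * 1)) ≡ u * (u * B * B)
  regroup = solve-∀

lemma2p3 : (b d₁ d₂ u₁ u₂ : ℕ) →
    3 ≤ b → d₁ < d₂ → d₂ ≤ b ∸ 1 →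
    1 ≤ u₁ → 1 ≤ u₂ → u₁ * u₂ ≡ d₂ ∸ d₁ →
    (∀ p → Prime p → p ∣ u₁ → p ∣ b) →
    (∀ p → Prime p → p ∣ u₂ → ¬ (p ∣ b)) →
    let N = φ (u₂ ^ 2 * (b ∸ 1) ^ 2)
        m₁ = N ∸ 1
    in (u₁ ∣ b ^ m₁)
       × (u₂ * ↧ₙ (expansion b (replicate m₁ d₁) (d₂ ∷ replicate m₁ d₁)) ≡ b ^ N ∸ 1)
lemma2p3 b@(suc B@(suc (suc _))) d₁ d₂ u₁ u₂ (s≤s (s≤s (s≤s _))) d₁<d₂ d₂≤B
         1≤u₁ 1≤u₂ u₁u₂≡d₂-d₁ u₁-primes u₂-primes =
  u₁∣bᵐ ,
  trans (periodic-denominator B m d₁ d₂ u₁ u₂ d₂≡ u₁∣bᵐ u₂B²∣bᵐ⁺¹-1) (cong (λ e → b ^ e ∸ 1) (sym N≡1+m))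
  where
  instance
    u₂≢0 : NonZero u₂
    u₂≢0 = >-nonZero 1≤u₂
  N = φ (u₂ ^ 2 * B ^ 2)
  m = N ∸ 1
  N≡1+m : N ≡ suc m
  N≡1+m = sym (m+[n∸m]≡n (≤-trans (s≤s z≤n) (φ-bound u₂ B)))
  d₂≡ : d₂ ≡ d₁ + u₁ * u₂
  d₂≡ = trans (sym (m+[n∸m]≡n (<⇒≤ d₁<d₂))) (cong (d₁ +_) (sym u₁u₂≡d₂-d₁))
  u₁≤B : u₁ ≤ B
  u₁≤B = ≤-trans (m≤m*n u₁ u₂) (≤-trans (≤-reflexive u₁u₂≡d₂-d₁) (≤-trans (m∸n≤m d₂ d₁) d₂≤B))
  u₁∣bᵐ : u₁ ∣ b ^ m
  u₁∣bᵐ = radical∣b⇒∣power u₁ b m 1≤u₁ u₁-primes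
    (subst (u₁ ≤_) N≡1+m (≤-trans u₁≤B (φ-bound u₂ B)))
  u₂B²∣bᵐ⁺¹-1 : u₂ * B * B ∣ b ^ suc m ∸ 1
  u₂B²∣bᵐ⁺¹-1 = subst (λ e → u₂ * B * B ∣ b ^ e ∸ 1) N≡1+m
    (u₂B²∣bᴺ-1 u₂ B (s≤s (s≤s z≤n)) 1≤u₂ (no-common-prime⇒coprime b u₂ 1≤u₂ u₂-primes))
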